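{- Let $r,J,K\ge1$ and let $c_{js},d_{ks}\in\mathbb N$ ($1\le j\le J$, $1\le k\le K$, $1\le s\le r$) be such that $\sum_{j=1}^Jc_{js}=\sum_{k=1}^Kd_{ks}$ for $s=1,\dots,r$. Put $C_j(x)=\sum_sc_{js}x_s$, $D_k(x)=\sum_sd_{ks}x_s$, and assume no $C_j$ or $D_k$ is identically zero, $C_j\neq D_k$ for all $j,k$, and for each $s$ some $c_{js}$ or some $d_{ks}$ is nonzero. Let $n=r+J+K$, $N=n+r$, $M=r+J$, let $\mathbf a_1,\dots,\mathbf a_n$ be the standard unit basis vectors of $\mathbb R^n$ and, for $s=1,\dots,r$, $\mathbf a_{n+s}=(e_s,c_{1s},\dots,c_{Js},-d_{1s},\dots,-d_{Ks})\in\mathbb Z^n$, where $e_s\in\mathbb Z^r$ is the $s$-th unit vector; let $A=\{\mathbf a_1,\dots,\mathbf a_N\}$. If \[M=\min\Big\{\sum_{i=1}^nu_i\ \Big|\ u=(u_1,\dots,u_n)\in C(A)^\circ\cap\mathbb Z^n\Big\},\] then for every $u\in(-C(A)^\circ)\cap\mathbb Z^n$ the series $F_u(\Lambda)$ has integral coefficients.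
   Context: $\mathbb N$ denotes the nonnegative integers. $C(A)\subseteq\mathbb R^n$ is the real cone generated by $A$ and $C(A)^\circ$ its interior. For $u\in(-C(A)^\circ)\cap\mathbb Z^n$, $F_u(\Lambda)$ is the formal Laurent series in $\Lambda_1,\dots,\Lambda_N$ \[F_u(\Lambda)=\sum_{\substack{l\in\mathbb N^N\\ \sum_{j=1}^M(-l_j-1)\mathbf a_j+\sum_{j=M+1}^N l_j\mathbf a_j=u}}(-1)^{\sum_{j=1}^M l_j}\frac{\prod_{j=1}^M l_j!}{\prod_{j=M+1}^N l_j!}\,\Lambda_1^{ -l_1-1}\cdots\Lambda_M^{ -l_M-1}\Lambda_{M+1}^{l_{M+1}}\cdots\Lambda_N^{l_N},\] with rational coefficients; "integral coefficients" means all coefficients lie in $\mathbb Z$. -}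

module Defs where

open import Data.Nat as ℕ using (ℕ; zero; suc; _!; NonZero)
open import Data.Nat.Properties as ℕP using (_!≢0; m*n≢0)
open import Data.Integer as ℤ using (ℤ; +_; -_)
open import Data.Rational as ℚ using (ℚ; _/_)
open import Data.Fin as Fin using (Fin; zero; suc; toℕ; splitAt)
open import Data.Sum using (_⊎_; inj₁; inj₂)
open import Data.Product using (Σ; ∃; _×_)
open import Relation.Binary.PropositionalEquality using (_≡_)
open import Relation.Nullary using (does)
open import Data.Bool using (if_then_else_)

sumℕ : ∀ {n} → (Fin n → ℕ) → ℕ
sumℕ {zero}  f = 0
sumℕ {suc n} f = f zero ℕ.+ sumℕ (λ i → f (suc i))

prodℕ : ∀ {n} → (Fin n → ℕ) → ℕ
prodℕ {zero}  f = 1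
prodℕ {suc n} f = f zero ℕ.* prodℕ (λ i → f (suc i))

sumℤ : ∀ {n} → (Fin n → ℤ) → ℤ
sumℤ {zero}  f = + 0
sumℤ {suc n} f = f zero ℤ.+ sumℤ (λ i → f (suc i))

sumℚ : ∀ {n} → (Fin n → ℚ) → ℚ
sumℚ {zero}  f = ℚ.0ℚ
sumℚ {suc n} f = f zero ℚ.+ sumℚ (λ i → f (suc i))

toℚ : ℤ → ℚ
toℚ z = z / 1

InCone : ∀ {n N} → (Fin N → Fin n → ℤ) → (Fin n → ℚ) → Set
InCone {n} {N} a v =
  Σ (Fin N → ℚ) λ λs →
    ((i : Fin N) → ℚ.0ℚ ℚ.≤ λs i) ×
    ((t : Fin n) → sumℚ (λ i → λs i ℚ.* toℚ (a i t)) ≡ v t)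

InInterior : ∀ {n N} → (Fin N → Fin n → ℤ) → (Fin n → ℚ) → Set
InInterior {n} {N} a v =
  Σ ℚ λ ε → (ℚ.0ℚ ℚ.< ε) ×
    ((w : Fin n → ℚ) → ((t : Fin n) → ℚ.∣ w t ℚ.- v t ∣ ℚ.≤ ε) → InCone a w)

module Config (r J K : ℕ) (c : Fin J → Fin r → ℕ) (d : Fin K → Fin r → ℕ) where

  n : ℕ
  n = r ℕ.+ J ℕ.+ K

  N : ℕ
  N = n ℕ.+ r

  M : ℕ
  M = r ℕ.+ J

  unit : ∀ {m} → Fin m → Fin m → ℤ
  unit i t = if does (i Fin.≟ t) then + 1 else + 0

  -- a_{n+s} = (e_s, c_{1s},…,c_{Js}, -d_{1s},…,-d_{Ks})
  extra : Fin r → Fin n → ℤ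
  extra s t with splitAt (r ℕ.+ J) t
  ... | inj₂ k = - (+ d k s)
  ... | inj₁ t' with splitAt r t'
  ...   | inj₁ s' = unit s s'
  ...   | inj₂ j  = + c j s

  a : Fin N → Fin n → ℤ
  a i with splitAt n i
  ... | inj₁ i' = unit i'
  ... | inj₂ s  = extra s

  -- the exponent vector condition:
  --   Σ_{j≤M} (-l_j - 1) a_j + Σ_{j>M} l_j a_j = u
  weight : (Fin N → ℕ) → Fin N → ℤ
  weight l j = if does (toℕ j ℕ.<? M) then - (+ suc (l j)) else + l j

  Support : (Fin N → ℕ) → (Fin n → ℤ) → Set
  Support l u = (t : Fin n) → sumℤ (λ j → weight l j ℤ.* a j t) ≡ u t

  -- the coefficient (-1)^{Σ_{j≤M} l_j} Π_{j≤M} l_j! / Π_{j>M} l_j!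
  numFactor : (Fin N → ℕ) → Fin N → ℕ
  numFactor l j = if does (toℕ j ℕ.<? M) then l j ! else 1

  denFactor : (Fin N → ℕ) → Fin N → ℕ
  denFactor l j = if does (toℕ j ℕ.<? M) then 1 else l j !

  sign : ℕ → ℤ
  sign zero    = + 1
  sign (suc k) = - sign k

  private
    prodNZ : ∀ {m} (f : Fin m → ℕ) → ((i : Fin m) → NonZero (f i)) → NonZero (prodℕ f)
    prodNZ {zero}  f h = _
    prodNZ {suc m} f h =
      m*n≢0 (f zero) (prodℕ (λ i → f (suc i)))
        {{h zero}} {{prodNZ (λ i → f (suc i)) (λ i → h (suc i))}}

    denNZ : (l : Fin N → ℕ) → NonZero (prodℕ (denFactor l))
    denNZ l = prodNZ (denFactor l) h
      where
      h : (j : Fin N) → NonZero (denFactor l j)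
      h j with does (toℕ j ℕ.<? M)
      ... | Data.Bool.true  = _
      ... | Data.Bool.false = l j !≢0

  coeff : (Fin N → ℕ) → ℚ
  coeff l = _/_ (sign (sumℕ (λ j → if does (toℕ j ℕ.<? M) then l j else 0))
                   ℤ.* (+ prodℕ (numFactor l)))
                (prodℕ (denFactor l)) {{denNZ l}}

  IntegralCoeffs : (Fin n → ℤ) → Set
  IntegralCoeffs u = (l : Fin N → ℕ) → Support l u → Σ ℤ λ z → coeff l ≡ toℚ z

{-# OPTIONS --safe #-}
-- By Legendre's formula, Landau's criterion holds: ∏_j g_j! divides ∏_j f_j! as soon as
-- Σ_j ⌊g_j/q⌋ ≤ Σ_j ⌊f_j/q⌋ for every q ≥ 1. Up to sign the coefficient of F_u indexed by l is
-- ∏_{j≤M} l_j! / ∏_{j>M} l_j!, so it suffices to prove these inequalities for f = (l_j)_{j≤M}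
-- and g = (l_j)_{j>M}.
--
-- Let w(l) = Σ_{j≤M} (l_j + 1) a_j − Σ_{j>M} l_j a_j, so that the support condition reads
-- w(l) = −u ∈ C(A)°. Every generator has coordinate sum 1 (for a_{n+s} this is the balancing
-- Σ_j c_js = Σ_k d_ks), hence w(l) has coordinate sum M + Σ_{j≤M} l_j − Σ_{j>M} l_j. As
-- l_j + 1 ≤ q (⌊l_j/q⌋ + 1) and q ⌊l_j/q⌋ ≤ l_j, the vector q w(⌊l/q⌋) − w(l) is a nonnegative
-- integer combination of generators, so w(⌊l/q⌋) lies in C(A)° as well, and the minimality of M
-- applied to it is exactly the inequality for q.
module Submission where

open import Defs
open import Data.Bool using (true; false; if_then_else_)
open import Data.Nat as ℕ using (ℕ; zero; suc; _!)
open import Data.Integer as ℤ using (ℤ)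
open import Data.Fin using (Fin; zero; suc; toℕ; splitAt; _↑ˡ_; _↑ʳ_)
open import Data.Fin.Properties using (splitAt-↑ˡ; splitAt-↑ʳ; splitAt⁻¹-↑ˡ; splitAt⁻¹-↑ʳ)
open import Data.Product using (∃-syntax; _,_)
open import Data.Sum using (inj₁; inj₂)
open import Relation.Binary.PropositionalEquality
open import Relation.Nullary using (does; yes; no)

module NatSums where

  open import Data.Nat
  open import Data.Nat.Properties
  open import Algebra.Properties.CommutativeSemigroup +-commutativeSemigroup using (interchange)

  sumℕ-cong : ∀ {m} {f g : Fin m → ℕ} → (∀ i → f i ≡ g i) → sumℕ f ≡ sumℕ g
  sumℕ-cong {zero}  f≗g = refl
  sumℕ-cong {suc m} f≗g = cong₂ _+_ (f≗g zero) (sumℕ-cong (λ i → f≗g (suc i)))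

  sumℕ-zero : ∀ m → sumℕ {m} (λ _ → 0) ≡ 0
  sumℕ-zero zero    = refl
  sumℕ-zero (suc m) = sumℕ-zero m

  sumℕ-distrib-+ : ∀ {m} (f g : Fin m → ℕ) → sumℕ (λ i → f i + g i) ≡ sumℕ f + sumℕ g
  sumℕ-distrib-+ {zero}  f g = refl
  sumℕ-distrib-+ {suc m} f g =
    trans (cong (f zero + g zero +_) (sumℕ-distrib-+ (λ i → f (suc i)) (λ i → g (suc i))))
          (interchange (f zero) (g zero) _ _)

  sumℕ-swap : ∀ {m k} (f : Fin m → Fin k → ℕ) →
              sumℕ (λ i → sumℕ (f i)) ≡ sumℕ (λ j → sumℕ (λ i → f i j))
  sumℕ-swap {zero}  {k} f = sym (sumℕ-zero k)
  sumℕ-swap {suc m} f = trans (cong (sumℕ (f zero) +_) (sumℕ-swap (λ i → f (suc i))))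
                              (sym (sumℕ-distrib-+ (f zero) (λ j → sumℕ (λ i → f (suc i) j))))

  sumℕ-mono-≤ : ∀ {m} {f g : Fin m → ℕ} → (∀ i → f i ≤ g i) → sumℕ f ≤ sumℕ g
  sumℕ-mono-≤ {zero}  f≤g = z≤n
  sumℕ-mono-≤ {suc m} f≤g = +-mono-≤ (f≤g zero) (sumℕ-mono-≤ (λ i → f≤g (suc i)))

  ≤-sumℕ : ∀ {m} (f : Fin m → ℕ) i → f i ≤ sumℕ f
  ≤-sumℕ f zero    = m≤m+n (f zero) _
  ≤-sumℕ f (suc i) = ≤-trans (≤-sumℕ (λ j → f (suc j)) i) (m≤n+m _ (f zero))

  count-< : ∀ {m k} → k ≤ m → sumℕ {m} (λ i → if does (toℕ i <? k) then 1 else 0) ≡ k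
  count-< {zero}  {zero}  z≤n       = refl
  count-< {suc m} {zero}  z≤n       = count-< {m} z≤n
  count-< {suc m} {suc k} (s≤s k≤m) = cong suc (count-< k≤m)

  prodℕ-cong : ∀ {m} {f g : Fin m → ℕ} → (∀ i → f i ≡ g i) → prodℕ f ≡ prodℕ g
  prodℕ-cong {zero}  f≗g = refl
  prodℕ-cong {suc m} f≗g = cong₂ _*_ (f≗g zero) (prodℕ-cong (λ i → f≗g (suc i)))

  prodℕ-nonZero : ∀ {m} (f : Fin m → ℕ) → (∀ i → NonZero (f i)) → NonZero (prodℕ f)
  prodℕ-nonZero {zero}  f f≢0 = _
  prodℕ-nonZero {suc m} f f≢0 =
    m*n≢0 (f zero) _ {{f≢0 zero}} {{prodℕ-nonZero (λ i → f (suc i)) (λ i → f≢0 (suc i))}}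

module ExactPowers where

  open import Data.Nat
  open import Data.Nat.Properties
  open import Data.Nat.Divisibility
  open import Data.Nat.Primality
  open import Data.Nat.Primality.Factorisation using (factorise)
  open import Data.Nat.ListAction using (product)
  open import Data.Nat.Induction using (<-wellFounded)
  open import Data.List using ([]; _∷_)
  open import Data.List.Relation.Unary.All using (All; []; _∷_)
  open import Data.Empty using (⊥-elim)
  open import Data.Sum using ([_,_]′)
  open import Induction.WellFounded using (Acc; acc)
  open import Algebra.Properties.CommutativeSemigroup *-commutativeSemigroup
    using (interchange; x∙yz≈z∙xy)
  open ≡-Reasoning

  infix 4 _^_∥_

  record _^_∥_ (p v m : ℕ) : Set where
    constructor exactly
    field
      cofactor       : ℕ
      m≡p^v*cofactor : m ≡ p ^ v * cofactor
      p∤cofactor     : p ∤ cofactor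

  ∥-exists : ∀ {p} → 1 < p → ∀ m .{{_ : NonZero m}} → ∃[ v ] p ^ v ∥ m
  ∥-exists {p} 1<p m = go m (<-wellFounded m)
    where
    go : ∀ m .{{_ : NonZero m}} → Acc _<_ m → ∃[ v ] p ^ v ∥ m
    go m (acc smaller) with p ∣? m
    ... | no p∤m = 0 , exactly m (sym (*-identityˡ m)) p∤m
    ... | yes (divides k m≡k*p) with go k {{k≢0}} (smaller k<m)
      where
      k≢0 : NonZero k
      k≢0 = ≢-nonZero λ k≡0 → ≢-nonZero⁻¹ m (trans m≡k*p (cong (_* p) k≡0))
      k<m : k < m
      k<m = subst (k <_) (sym m≡k*p) (m<m*n k p {{k≢0}} 1<p)
    ...   | v , exactly y k≡p^v*y p∤y = suc v , exactly y (begin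
      m               ≡⟨ m≡k*p ⟩
      k * p           ≡⟨ cong (_* p) k≡p^v*y ⟩
      p ^ v * y * p   ≡⟨ *-comm (p ^ v * y) p ⟩
      p * (p ^ v * y) ≡⟨ *-assoc p (p ^ v) y ⟨
      p ^ suc v * y   ∎) p∤y

  prime⇒1<p : ∀ {p} → Prime p → 1 < p
  prime⇒1<p {p} p-prime = nonTrivial⇒n>1 p {{prime⇒nonTrivial p-prime}}

  ^-monoʳ-∣ : ∀ p {e v} → e ≤ v → p ^ e ∣ p ^ v
  ^-monoʳ-∣ p {e} {v} e≤v = divides (p ^ (v ∸ e)) (begin
    p ^ v               ≡⟨ cong (p ^_) (m∸n+n≡m e≤v) ⟨
    p ^ (v ∸ e + e)     ≡⟨ ^-distribˡ-+-* p (v ∸ e) e ⟩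
    p ^ (v ∸ e) * p ^ e ∎)

  ∥-1 : ∀ {p} → Prime p → p ^ 0 ∥ 1
  ∥-1 p-prime = exactly 1 refl λ p∣1 → <-irrefl (sym (∣1⇒≡1 p∣1)) (prime⇒1<p p-prime)

  ∥-* : ∀ {p v w m n} → Prime p → p ^ v ∥ m → p ^ w ∥ n → p ^ (v + w) ∥ m * n
  ∥-* {p} {v} {w} {m} {n} p-prime (exactly y m≡ p∤y) (exactly z n≡ p∤z) = exactly (y * z) (begin
    m * n                   ≡⟨ cong₂ _*_ m≡ n≡ ⟩
    p ^ v * y * (p ^ w * z) ≡⟨ interchange (p ^ v) y (p ^ w) z ⟩
    p ^ v * p ^ w * (y * z) ≡⟨ cong (_* (y * z)) (^-distribˡ-+-* p v w) ⟨
    p ^ (v + w) * (y * z)   ∎)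
    λ p∣y*z → [ p∤y , p∤z ]′ (euclidsLemma y z p-prime p∣y*z)

  ∥-prodℕ : ∀ {p m} → Prime p → (f v : Fin m → ℕ) → (∀ i → p ^ v i ∥ f i) →
            p ^ sumℕ v ∥ prodℕ f
  ∥-prodℕ {m = zero}  p-prime f v f∥ = ∥-1 p-prime
  ∥-prodℕ {m = suc m} p-prime f v f∥ =
    ∥-* p-prime (f∥ zero) (∥-prodℕ p-prime (λ i → f (suc i)) (λ i → v (suc i)) (λ i → f∥ (suc i)))

  ∥∧≤⇒∣ : ∀ {p v m e} → p ^ v ∥ m → e ≤ v → p ^ e ∣ m
  ∥∧≤⇒∣ {p} (exactly y m≡p^v*y _) e≤v =
    subst (_ ∣_) (sym m≡p^v*y) (∣-trans (^-monoʳ-∣ p e≤v) (m∣m*n y))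

  ∥∧∣⇒≤ : ∀ {p v m e} .{{_ : NonZero p}} → p ^ v ∥ m → p ^ e ∣ m → e ≤ v
  ∥∧∣⇒≤ {p} {v} {m} {e} (exactly y m≡p^v*y p∤y) p^e∣m with e ≤? v
  ... | yes e≤v = e≤v
  ... | no e≰v = ⊥-elim (p∤y (*-cancelˡ-∣ (p ^ v) {{m^n≢0 p v}} p^v*p∣p^v*y))
    where
    p^v*p∣p^v*y : p ^ v * p ∣ p ^ v * y
    p^v*p∣p^v*y = subst₂ _∣_ (*-comm p (p ^ v)) m≡p^v*y (∣-trans (^-monoʳ-∣ p (≰⇒> e≰v)) p^e∣m)

  ∤-cancelˡ-∣ : ∀ {p k m} e → Prime p → p ∤ k → p ^ e ∣ k * m → p ^ e ∣ m
  ∤-cancelˡ-∣ {m = m} zero p-prime p∤k _ = 1∣ m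
  ∤-cancelˡ-∣ {p} {k} {m} (suc e) p-prime p∤k p^[1+e]∣k*m
    with euclidsLemma k m p-prime (∣-trans (m∣m*n (p ^ e)) p^[1+e]∣k*m)
  ... | inj₁ p∣k = ⊥-elim (p∤k p∣k)
  ... | inj₂ (divides m′ m≡m′*p) = subst (p ^ suc e ∣_) (trans (*-comm p m′) (sym m≡m′*p))
      (*-monoʳ-∣ p (∤-cancelˡ-∣ e p-prime p∤k p^e∣k*m′))
    where
    p^e∣k*m′ : p ^ e ∣ k * m′
    p^e∣k*m′ = *-cancelˡ-∣ p {{prime⇒nonZero p-prime}}
      (subst (p * p ^ e ∣_) (trans (cong (k *_) m≡m′*p) (x∙yz≈z∙xy k m′ p)) p^[1+e]∣k*m)

  ∥-cancelˡ-∣ : ∀ {p v k m} e → Prime p → p ^ v ∥ k → p ^ (v + e) ∣ k * m → p ^ e ∣ m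
  ∥-cancelˡ-∣ {p} {v} {k} {m} e p-prime (exactly k′ k≡p^v*k′ p∤k′) p^[v+e]∣k*m =
    ∤-cancelˡ-∣ e p-prime p∤k′ (*-cancelˡ-∣ (p ^ v) {{m^n≢0 p v {{prime⇒nonZero p-prime}}}}
      (subst₂ _∣_ (^-distribˡ-+-* p v e) (trans (cong (_* m) k≡p^v*k′) (*-assoc (p ^ v) k′ m))
              p^[v+e]∣k*m))

  ∣-by-primePowers : ∀ n .{{_ : NonZero n}} m →
                     (∀ p e → Prime p → p ^ e ∣ n → p ^ e ∣ m) → n ∣ m
  ∣-by-primePowers n m primePowers∣ with factorise n
  ... | record { factors = ps ; isFactorisation = n≡∏ps ; factorsPrime = ps-prime } =
    subst (_∣ m) (sym n≡∏ps) (product-∣ ps ps-prime m λ p e p-prime p^e∣∏ps →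
      primePowers∣ p e p-prime (subst (p ^ e ∣_) (sym n≡∏ps) p^e∣∏ps))
    where
    product-∣ : ∀ ps → All Prime ps → ∀ m →
                (∀ q e → Prime q → q ^ e ∣ product ps → q ^ e ∣ m) → product ps ∣ m
    product-∣ [] [] m _ = 1∣ m
    product-∣ (p ∷ ps) (p-prime ∷ ps-prime) m primePowers∣ =
      subst (p * product ps ∣_) (sym m≡p*m′) (*-monoʳ-∣ p (product-∣ ps ps-prime m′ primePowers∣′))
      where
      p∣m : p ∣ m
      p∣m = subst (_∣ m) (*-identityʳ p) (primePowers∣ p 1 p-prime
              (subst (_∣ p * product ps) (sym (*-identityʳ p)) (m∣m*n (product ps))))
      m′ : ℕ
      m′ = quotient p∣m
      m≡p*m′ : m ≡ p * m′
      m≡p*m′ = m∣n⇒n≡m*quotient p∣m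
      primePowers∣′ : ∀ q e → Prime q → q ^ e ∣ product ps → q ^ e ∣ m′
      primePowers∣′ q e q-prime q^e∣∏ps
        with ∥-exists (prime⇒1<p q-prime) p {{prime⇒nonZero p-prime}}
      ... | v , q^v∥p = ∥-cancelˡ-∣ e q-prime q^v∥p (subst (q ^ (v + e) ∣_) m≡p*m′
            (primePowers∣ q (v + e) q-prime (subst (_∣ p * product ps) (sym (^-distribˡ-+-* q v e))
              (*-pres-∣ (∥∧≤⇒∣ q^v∥p ≤-refl) q^e∣∏ps))))

module Quotients where

  open import Data.Nat
  open import Data.Nat.Properties
  open import Data.Nat.DivMod
  open import Data.Nat.Divisibility

  m<n*[1+m/n] : ∀ m n .{{_ : NonZero n}} → m < n * suc (m / n)
  m<n*[1+m/n] m n = begin-strict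
    m                 ≡⟨ m≡m%n+[m/n]*n m n ⟩
    m % n + m / n * n <⟨ +-monoˡ-< (m / n * n) (m%n<n m n) ⟩
    n + m / n * n     ≡⟨ cong (n +_) (*-comm (m / n) n) ⟩
    n + n * (m / n)   ≡⟨ *-suc n (m / n) ⟨
    n * suc (m / n)   ∎
    where open ≤-Reasoning

  /-suc : ∀ n d .{{_ : NonZero d}} → suc n / d ≡ n / d + (if does (d ∣? suc n) then 1 else 0)
  /-suc n d with d ∣? suc n
  ... | yes (divides (suc k) 1+n≡[1+k]*d) = begin
    suc n / d     ≡⟨ /-congˡ 1+n≡[1+k]*d ⟩
    suc k * d / d ≡⟨ m*n/n≡m (suc k) d ⟩
    suc k         ≡⟨ +-comm 1 k ⟩
    k + 1         ≡⟨ cong (_+ 1) n/d≡k ⟨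
    n / d + 1     ∎
    where
    open ≡-Reasoning
    n≡pred[d]+k*d : n ≡ pred d + k * d
    n≡pred[d]+k*d = suc-injective (trans 1+n≡[1+k]*d (cong (_+ k * d) (sym (suc-pred d))))
    n/d≡k : n / d ≡ k
    n/d≡k = begin
      n / d                  ≡⟨ /-congˡ n≡pred[d]+k*d ⟩
      (pred d + k * d) / d   ≡⟨ +-distrib-/-∣ʳ (pred d) (n∣m*n k) ⟩
      pred d / d + k * d / d ≡⟨ cong₂ _+_ (m<n⇒m/n≡0 (≤-reflexive (suc-pred d))) (m*n/n≡m k d) ⟩
      k                      ∎
  ... | no d∤1+n = begin
    suc n / d     ≡⟨ /-congˡ (+-comm 1 n) ⟩
    (n + 1) / d   ≡⟨ +-distrib-/ n 1 n%d+1%d<d ⟩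
    n / d + 1 / d ≡⟨ cong (n / d +_) (m<n⇒m/n≡0 1<d) ⟩
    n / d + 0     ∎
    where
    open ≡-Reasoning
    1<d : 1 < d
    1<d = ≤∧≢⇒< (>-nonZero⁻¹ d) λ 1≡d → d∤1+n (subst (_∣ suc n) 1≡d (1∣ suc n))
    1+n%d≢d : suc (n % d) ≢ d
    1+n%d≢d 1+n%d≡d = d∤1+n (divides (suc (n / d)) (begin
      suc n                   ≡⟨ cong suc (m≡m%n+[m/n]*n n d) ⟩
      suc (n % d) + n / d * d ≡⟨ cong (_+ n / d * d) 1+n%d≡d ⟩
      d + n / d * d           ∎))
    n%d+1%d<d : n % d + 1 % d < d
    n%d+1%d<d = subst (_< d) (sym (trans (cong (n % d +_) (m<n⇒m%n≡m 1<d)) (+-comm (n % d) 1)))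
                  (≤∧≢⇒< (m%n<n n d) 1+n%d≢d)

module Legendre where

  open import Data.Nat
  open import Data.Nat.Properties
  open import Data.Nat.DivMod
  open import Data.Nat.Divisibility
  open import Data.Nat.Primality
  open import Relation.Nullary.Decidable using (does-⇔)
  open import Function.Bundles using (mk⇔)
  open NatSums
  open ExactPowers
  open Quotients

  ⌊_/_^_⌋ : ℕ → ∀ p .{{_ : NonZero p}} → ℕ → ℕ
  ⌊ n / p ^ k ⌋ = (n / p ^ k) {{m^n≢0 p k}}

  -- Σ_{i ≥ 1} ⌊n / p^i⌋ cut off after B terms; the omitted terms vanish when n ≤ B.
  legendre : ∀ p .{{_ : NonZero p}} → ℕ → ℕ → ℕ
  legendre p B n = sumℕ {B} (λ i → ⌊ n / p ^ suc (toℕ i) ⌋)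

  n<p^n : ∀ {p} → 1 < p → ∀ n → n < p ^ n
  n<p^n 1<p zero = z<s
  n<p^n {p@(suc _)} 1<p (suc n) = begin-strict
    suc n       <⟨ s<s (n<p^n 1<p n) ⟩
    suc (p ^ n) ≤⟨ m<m*n (p ^ n) p {{m^n≢0 p n}} 1<p ⟩
    p ^ n * p   ≡⟨ *-comm (p ^ n) p ⟩
    p ^ suc n   ∎
    where open ≤-Reasoning

  module _ {p : ℕ} (p-prime : Prime p) where

    private instance
      p≢0 : NonZero p
      p≢0 = prime⇒nonZero p-prime

    legendre-zero : ∀ B → legendre p B 0 ≡ 0
    legendre-zero B = trans (sumℕ-cong {B} (λ i → 0/n≡0 (p ^ suc (toℕ i)) {{m^n≢0 p (suc (toℕ i))}}))
                            (sumℕ-zero B)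

    legendre-suc : ∀ {B n v} → p ^ v ∥ suc n → v ≤ B → legendre p B (suc n) ≡ legendre p B n + v
    legendre-suc {B} {n} {v} p^v∥1+n v≤B = begin
      legendre p B (suc n)
        ≡⟨ sumℕ-cong {B} (λ i → /-suc n (p ^ suc (toℕ i)) {{m^n≢0 p (suc (toℕ i))}}) ⟩
      sumℕ {B} (λ i → ⌊ n / p ^ suc (toℕ i) ⌋ + [p^[1+i]∣1+n] i)
        ≡⟨ sumℕ-distrib-+ {B} _ _ ⟩
      legendre p B n + sumℕ [p^[1+i]∣1+n]
        ≡⟨ cong (legendre p B n +_) (trans (sumℕ-cong [p^[1+i]∣1+n]≡[i<v]) (count-< v≤B)) ⟩
      legendre p B n + v ∎
      where
      open ≡-Reasoning
      [p^[1+i]∣1+n] : Fin B → ℕ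
      [p^[1+i]∣1+n] i = if does (p ^ suc (toℕ i) ∣? suc n) then 1 else 0
      [p^[1+i]∣1+n]≡[i<v] : ∀ i → [p^[1+i]∣1+n] i ≡ (if does (toℕ i <? v) then 1 else 0)
      [p^[1+i]∣1+n]≡[i<v] i = cong (λ b → if b then 1 else 0)
        (does-⇔ (mk⇔ (∥∧∣⇒≤ p^v∥1+n) (∥∧≤⇒∣ p^v∥1+n)) (p ^ suc (toℕ i) ∣? suc n) (toℕ i <? v))

    legendre-∥ : ∀ {B} n → n ≤ B → p ^ legendre p B n ∥ n !
    legendre-∥ {B} zero _ = subst (λ e → p ^ e ∥ 1) (sym (legendre-zero B)) (∥-1 p-prime)
    legendre-∥ {B} (suc n) 1+n≤B with ∥-exists (prime⇒1<p p-prime) (suc n)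
    ... | v , p^v∥1+n =
      subst (λ e → p ^ e ∥ suc n !) (trans (+-comm v _) (sym (legendre-suc p^v∥1+n v≤B)))
            (∥-* p-prime p^v∥1+n (legendre-∥ n (≤-trans (n≤1+n n) 1+n≤B)))
      where
      v≤B : v ≤ B
      v≤B = ≤-trans (<⇒≤ (n<p^n (prime⇒1<p p-prime) v))
                    (≤-trans (∣⇒≤ (∥∧≤⇒∣ p^v∥1+n ≤-refl)) 1+n≤B)

  landau : ∀ {m} (f g : Fin m → ℕ) →
           (∀ q .{{_ : NonZero q}} → sumℕ (λ j → g j / q) ≤ sumℕ (λ j → f j / q)) →
           prodℕ (λ j → g j !) ∣ prodℕ (λ j → f j !)
  landau f g floorSums≤ =
    ∣-by-primePowers _ {{prodℕ-nonZero _ (λ j → g j !≢0)}} _ primePowers∣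
    where
    B = sumℕ f + sumℕ g
    primePowers∣ : ∀ p e → Prime p → p ^ e ∣ prodℕ (λ j → g j !) → p ^ e ∣ prodℕ (λ j → f j !)
    primePowers∣ p e p-prime p^e∣∏g! =
      ∥∧≤⇒∣ (∏!-∥ f (λ j → m≤n⇒m≤n+o _ (≤-sumℕ f j)))
            (≤-trans (∥∧∣⇒≤ {e = e} (∏!-∥ g (λ j → m≤n⇒m≤o+n _ (≤-sumℕ g j))) p^e∣∏g!) legendres≤)
      where
      instance
        p≢0 : NonZero p
        p≢0 = prime⇒nonZero p-prime
      ∏!-∥ : ∀ h → (∀ j → h j ≤ B) → p ^ sumℕ (λ j → legendre p B (h j)) ∥ prodℕ (λ j → h j !)
      ∏!-∥ h h≤B = ∥-prodℕ p-prime _ _ (λ j → legendre-∥ p-prime (h j) (h≤B j))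
      legendres≤ : sumℕ (λ j → legendre p B (g j)) ≤ sumℕ (λ j → legendre p B (f j))
      legendres≤ = subst₂ _≤_ (sym (sumℕ-swap {k = B} (λ j i → ⌊ g j / p ^ suc (toℕ i) ⌋)))
                              (sym (sumℕ-swap {k = B} (λ j i → ⌊ f j / p ^ suc (toℕ i) ⌋)))
                     (sumℕ-mono-≤ {B} (λ i → floorSums≤ (p ^ suc (toℕ i)) {{m^n≢0 p (suc (toℕ i))}}))

module Integers where

  open import Data.Integer hiding (suc)
  open import Data.Integer.Properties
  open import Data.Integer.Tactic.RingSolver using (solve-∀)
  open import Algebra.Properties.CommutativeSemigroup +-commutativeSemigroup using (interchange)

  sumℤ-cong : ∀ {m} {f g : Fin m → ℤ} → (∀ i → f i ≡ g i) → sumℤ f ≡ sumℤ g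
  sumℤ-cong {zero}  f≗g = refl
  sumℤ-cong {suc m} f≗g = cong₂ _+_ (f≗g zero) (sumℤ-cong (λ i → f≗g (suc i)))

  sumℤ-zero : ∀ m → sumℤ {m} (λ _ → 0ℤ) ≡ 0ℤ
  sumℤ-zero zero    = refl
  sumℤ-zero (suc m) = trans (+-identityˡ _) (sumℤ-zero m)

  sumℤ-distrib-+ : ∀ {m} (f g : Fin m → ℤ) → sumℤ (λ i → f i + g i) ≡ sumℤ f + sumℤ g
  sumℤ-distrib-+ {zero}  f g = refl
  sumℤ-distrib-+ {suc m} f g =
    trans (cong (_+_ (f zero + g zero)) (sumℤ-distrib-+ (λ i → f (suc i)) (λ i → g (suc i))))
          (interchange (f zero) (g zero) _ _)

  sumℤ-neg : ∀ {m} (f : Fin m → ℤ) → sumℤ (λ i → - f i) ≡ - sumℤ f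
  sumℤ-neg {zero}  f = refl
  sumℤ-neg {suc m} f = trans (cong (_+_ (- f zero)) (sumℤ-neg (λ i → f (suc i))))
                             (sym (neg-distrib-+ (f zero) _))

  *-distribˡ-sumℤ : ∀ {m} k (f : Fin m → ℤ) → k * sumℤ f ≡ sumℤ (λ i → k * f i)
  *-distribˡ-sumℤ {zero}  k f = *-zeroʳ k
  *-distribˡ-sumℤ {suc m} k f = trans (*-distribˡ-+ k (f zero) _)
                                      (cong (_+_ (k * f zero)) (*-distribˡ-sumℤ k (λ i → f (suc i))))

  sumℤ-swap : ∀ {m k} (f : Fin m → Fin k → ℤ) →
              sumℤ (λ i → sumℤ (f i)) ≡ sumℤ (λ j → sumℤ (λ i → f i j))
  sumℤ-swap {zero}  {k} f = sym (sumℤ-zero k)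
  sumℤ-swap {suc m} f = trans (cong (_+_ (sumℤ (f zero))) (sumℤ-swap (λ i → f (suc i))))
                              (sym (sumℤ-distrib-+ (f zero) (λ j → sumℤ (λ i → f (suc i) j))))

  sumℤ-↑ : ∀ m {k} (f : Fin (m ℕ.+ k) → ℤ) →
           sumℤ f ≡ sumℤ (λ i → f (i ↑ˡ k)) + sumℤ (λ j → f (m ↑ʳ j))
  sumℤ-↑ zero    f = sym (+-identityˡ _)
  sumℤ-↑ (suc m) f = trans (cong (_+_ (f zero)) (sumℤ-↑ m (λ i → f (suc i))))
                           (sym (+-assoc (f zero) _ _))

  sumℤ-pos : ∀ {m} (f : Fin m → ℕ) → sumℤ (λ i → + f i) ≡ + sumℕ f
  sumℤ-pos {zero}  f = refl
  sumℤ-pos {suc m} f = trans (cong (_+_ (+ f zero)) (sumℤ-pos (λ i → f (suc i))))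
                             (sym (pos-+ (f zero) _))

  sumℤ-pos-difference : ∀ {m} (f g : Fin m → ℕ) →
                        sumℤ (λ i → + f i - + g i) ≡ + sumℕ f - + sumℕ g
  sumℤ-pos-difference f g = trans (sumℤ-distrib-+ (λ i → + f i) (λ i → - + g i))
    (cong₂ _+_ (sumℤ-pos f) (trans (sumℤ-neg (λ i → + g i)) (cong -_ (sumℤ-pos g))))

  i≤i+j⇒0≤j : ∀ {i j} → i ≤ i + j → 0ℤ ≤ j
  i≤i+j⇒0≤j {i} {j} i≤i+j = subst (0ℤ ≤_) ([i+j]-i≡j i j) (i≤j⇒0≤j-i i≤i+j)
    where
    [i+j]-i≡j : ∀ i j → i + j - i ≡ j
    [i+j]-i≡j = solve-∀

module Rationals where

  open import Data.Rational
  open import Data.Rational.Properties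
  import Data.Rational.Unnormalised as ℚᵘ
  import Data.Rational.Unnormalised.Properties as ℚᵘ
  import Data.Integer.Properties as ℤP
  open import Data.Integer.Tactic.RingSolver using (solve-∀)
  open import Algebra.Bundles using (CommutativeMonoid)
  open import Algebra.Properties.CommutativeSemigroup
    (CommutativeMonoid.commutativeSemigroup +-0-commutativeMonoid) using (interchange)
  open ≡-Reasoning

  fromℚᵘ-homo-+ : ∀ p q → fromℚᵘ (p ℚᵘ.+ q) ≡ fromℚᵘ p + fromℚᵘ q
  fromℚᵘ-homo-+ p q = begin
    fromℚᵘ (p ℚᵘ.+ q)
      ≡⟨ fromℚᵘ-cong (ℚᵘ.+-cong (ℚᵘ.≃-sym (toℚᵘ-fromℚᵘ p)) (ℚᵘ.≃-sym (toℚᵘ-fromℚᵘ q))) ⟩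
    fromℚᵘ (toℚᵘ (fromℚᵘ p) ℚᵘ.+ toℚᵘ (fromℚᵘ q))
      ≡⟨ fromℚᵘ-cong (ℚᵘ.≃-sym (toℚᵘ-homo-+ (fromℚᵘ p) (fromℚᵘ q))) ⟩
    fromℚᵘ (toℚᵘ (fromℚᵘ p + fromℚᵘ q))
      ≡⟨ fromℚᵘ-toℚᵘ _ ⟩
    fromℚᵘ p + fromℚᵘ q ∎

  fromℚᵘ-homo-* : ∀ p q → fromℚᵘ (p ℚᵘ.* q) ≡ fromℚᵘ p * fromℚᵘ q
  fromℚᵘ-homo-* p q = begin
    fromℚᵘ (p ℚᵘ.* q)
      ≡⟨ fromℚᵘ-cong (ℚᵘ.*-cong (ℚᵘ.≃-sym (toℚᵘ-fromℚᵘ p)) (ℚᵘ.≃-sym (toℚᵘ-fromℚᵘ q))) ⟩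
    fromℚᵘ (toℚᵘ (fromℚᵘ p) ℚᵘ.* toℚᵘ (fromℚᵘ q))
      ≡⟨ fromℚᵘ-cong (ℚᵘ.≃-sym (toℚᵘ-homo-* (fromℚᵘ p) (fromℚᵘ q))) ⟩
    fromℚᵘ (toℚᵘ (fromℚᵘ p * fromℚᵘ q))
      ≡⟨ fromℚᵘ-toℚᵘ _ ⟩
    fromℚᵘ p * fromℚᵘ q ∎

  -- toℚ x is fromℚᵘ (mkℚᵘ x 0) by definition, so identities between integer fractions,
  -- which hold up to ≃ in ℚᵘ, become equations in ℚ.
  toℚ-+ : ∀ x y → toℚ (x ℤ.+ y) ≡ toℚ x + toℚ y
  toℚ-+ x y = trans (fromℚᵘ-cong {ℚᵘ.mkℚᵘ (x ℤ.+ y) 0} {ℚᵘ.mkℚᵘ x 0 ℚᵘ.+ ℚᵘ.mkℚᵘ y 0}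
                                 (ℚᵘ.*≡* (cross-multiplied x y)))
                    (fromℚᵘ-homo-+ (ℚᵘ.mkℚᵘ x 0) (ℚᵘ.mkℚᵘ y 0))
    where
    cross-multiplied : ∀ x y →
      (x ℤ.+ y) ℤ.* (ℤ.+ 1 ℤ.* ℤ.+ 1) ≡ (x ℤ.* ℤ.+ 1 ℤ.+ y ℤ.* ℤ.+ 1) ℤ.* ℤ.+ 1
    cross-multiplied = solve-∀

  toℚ-* : ∀ x y → toℚ (x ℤ.* y) ≡ toℚ x * toℚ y
  toℚ-* x y = trans (fromℚᵘ-cong {ℚᵘ.mkℚᵘ (x ℤ.* y) 0} {ℚᵘ.mkℚᵘ x 0 ℚᵘ.* ℚᵘ.mkℚᵘ y 0}
                                 (ℚᵘ.*≡* (cross-multiplied x y)))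
                    (fromℚᵘ-homo-* (ℚᵘ.mkℚᵘ x 0) (ℚᵘ.mkℚᵘ y 0))
    where
    cross-multiplied : ∀ x y → (x ℤ.* y) ℤ.* (ℤ.+ 1 ℤ.* ℤ.+ 1) ≡ (x ℤ.* y) ℤ.* ℤ.+ 1
    cross-multiplied = solve-∀

  /-exact : ∀ i j d .{{_ : ℕ.NonZero d}} → i ≡ j ℤ.* ℤ.+ d → i / d ≡ toℚ j
  /-exact i j (suc d) i≡j*d =
    fromℚᵘ-cong {ℚᵘ.mkℚᵘ i d} {ℚᵘ.mkℚᵘ j 0} (ℚᵘ.*≡* (trans (ℤP.*-identityʳ i) i≡j*d))

  toℚ-sumℤ : ∀ {m} (f : Fin m → ℤ) → toℚ (sumℤ f) ≡ sumℚ (λ i → toℚ (f i))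
  toℚ-sumℤ {zero}  f = refl
  toℚ-sumℤ {suc m} f = trans (toℚ-+ (f zero) _) (cong (toℚ (f zero) +_) (toℚ-sumℤ (λ i → f (suc i))))

  toℚ-nonNeg : ∀ n → 0ℚ ≤ toℚ (ℤ.+ n)
  toℚ-nonNeg n = nonNegative⁻¹ _ {{normalize-nonNeg n 1}}

  toℚ-pos : ∀ n .{{_ : ℕ.NonZero n}} → Positive (toℚ (ℤ.+ n))
  toℚ-pos (suc n) = normalize-pos (suc n) 1

  sumℚ-cong : ∀ {m} {f g : Fin m → ℚ} → (∀ i → f i ≡ g i) → sumℚ f ≡ sumℚ g
  sumℚ-cong {zero}  f≗g = refl
  sumℚ-cong {suc m} f≗g = cong₂ _+_ (f≗g zero) (sumℚ-cong (λ i → f≗g (suc i)))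

  sumℚ-distrib-+ : ∀ {m} (f g : Fin m → ℚ) → sumℚ (λ i → f i + g i) ≡ sumℚ f + sumℚ g
  sumℚ-distrib-+ {zero}  f g = refl
  sumℚ-distrib-+ {suc m} f g =
    trans (cong (f zero + g zero +_) (sumℚ-distrib-+ (λ i → f (suc i)) (λ i → g (suc i))))
          (interchange (f zero) (g zero) _ _)

  *-distribʳ-sumℚ : ∀ {m} q (f : Fin m → ℚ) → sumℚ f * q ≡ sumℚ (λ i → f i * q)
  *-distribʳ-sumℚ {zero}  q f = *-zeroˡ q
  *-distribʳ-sumℚ {suc m} q f = trans (*-distribʳ-+ q (f zero) _)
                                      (cong (f zero * q +_) (*-distribʳ-sumℚ q (λ i → f (suc i))))

module Combinations {n N : ℕ} (a : Fin N → Fin n → ℤ) where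

  open import Data.Integer hiding (suc)
  open import Data.Integer.Properties
  open import Data.Integer.Tactic.RingSolver using (solve-∀)
  open Integers
  open ≡-Reasoning

  combination : (Fin N → ℤ) → Fin n → ℤ
  combination x t = sumℤ (λ j → x j * a j t)

  combination-cong : ∀ {x y} → (∀ j → x j ≡ y j) → ∀ t → combination x t ≡ combination y t
  combination-cong x≗y t = sumℤ-cong (λ j → cong (_* a j t) (x≗y j))

  combination-+ : ∀ x y t → combination (λ j → x j + y j) t ≡ combination x t + combination y t
  combination-+ x y t = trans (sumℤ-cong (λ j → *-distribʳ-+ (a j t) (x j) (y j)))
                              (sumℤ-distrib-+ (λ j → x j * a j t) (λ j → y j * a j t))

  combination-* : ∀ k x t → combination (λ j → k * x j) t ≡ k * combination x t
  combination-* k x t = trans (sumℤ-cong (λ j → *-assoc k (x j) (a j t)))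
                              (sym (*-distribˡ-sumℤ k (λ j → x j * a j t)))

  combination-neg : ∀ x t → combination (λ j → - x j) t ≡ - combination x t
  combination-neg x t = trans (sumℤ-cong (λ j → sym (neg-distribˡ-* (x j) (a j t))))
                              (sumℤ-neg (λ j → x j * a j t))

  combination-+-difference : ∀ x z t →
                             combination x t + combination (λ j → z j - x j) t ≡ combination z t
  combination-+-difference x z t = trans (sym (combination-+ x (λ j → z j - x j) t))
                                         (combination-cong (λ j → x+[z-x]≡z (x j) (z j)) t)
    where
    x+[z-x]≡z : ∀ x z → x + (z - x) ≡ z
    x+[z-x]≡z = solve-∀

  sumℤ-combination : (∀ j → sumℤ (a j) ≡ 1ℤ) → ∀ x → sumℤ (combination x) ≡ sumℤ x
  sumℤ-combination Σa≡1 x = begin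
    sumℤ (λ t → sumℤ (λ j → x j * a j t)) ≡⟨ sumℤ-swap (λ t j → x j * a j t) ⟩
    sumℤ (λ j → sumℤ (λ t → x j * a j t)) ≡⟨ sumℤ-cong (λ j → *-distribˡ-sumℤ (x j) (a j)) ⟨
    sumℤ (λ j → x j * sumℤ (a j))         ≡⟨ sumℤ-cong (λ j → cong (_*_ (x j)) (Σa≡1 j)) ⟩
    sumℤ (λ j → x j * 1ℤ)                 ≡⟨ sumℤ-cong (λ j → *-identityʳ (x j)) ⟩
    sumℤ x                                ∎

module Cones {n N : ℕ} (a : Fin N → Fin n → ℤ) where

  open import Data.Rational
  open import Data.Rational.Properties
  open import Data.Rational.Solver using (module +-*-Solver)
  open import Data.Integer.Properties using (0≤i⇒+∣i∣≡i; i≤j⇒0≤j-i)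
  open import Algebra.Bundles using (CommutativeMonoid)
  open import Algebra.Properties.CommutativeSemigroup
    (CommutativeMonoid.commutativeSemigroup *-1-commutativeMonoid) using (xy∙z≈xz∙y; x∙yz≈y∙xz)
  open Rationals
  open Combinations a

  InCone-cong : ∀ {v w} → (∀ t → v t ≡ w t) → InCone a v → InCone a w
  InCone-cong v≗w (λs , λs≥0 , Σλa≡v) = λs , λs≥0 , λ t → trans (Σλa≡v t) (v≗w t)

  InInterior-cong : ∀ {v w} → (∀ t → v t ≡ w t) → InInterior a v → InInterior a w
  InInterior-cong v≗w (ε , ε>0 , ball⊆C) =
    ε , ε>0 , λ x x≈w → ball⊆C x (λ t → subst (λ y → ∣ x t - y ∣ ≤ ε) (sym (v≗w t)) (x≈w t))

  InCone-+ : ∀ {v w} → InCone a v → InCone a w → InCone a (λ t → v t + w t)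
  InCone-+ (λs , λs≥0 , Σλa≡v) (μs , μs≥0 , Σμa≡w) =
    (λ i → λs i + μs i) , (λ i → +-mono-≤ (λs≥0 i) (μs≥0 i)) , λ t →
      trans (sumℚ-cong (λ i → *-distribʳ-+ (toℚ (a i t)) (λs i) (μs i)))
            (trans (sumℚ-distrib-+ (λ i → λs i * toℚ (a i t)) (λ i → μs i * toℚ (a i t)))
                   (cong₂ _+_ (Σλa≡v t) (Σμa≡w t)))

  InInterior-+ : ∀ {v w} → InInterior a v → InCone a w → InInterior a (λ t → v t + w t)
  InInterior-+ {v} {w} (ε , ε>0 , ball⊆C) w∈C = ε , ε>0 , λ x x≈v+w →
    InCone-cong (λ t → [x-w]+w≡x (x t) (w t))
      (InCone-+ (ball⊆C (λ t → x t - w t)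
                        (λ t → subst (_≤ ε) (cong ∣_∣ (x-[v+w]≡[x-w]-v (x t) (v t) (w t))) (x≈v+w t)))
                w∈C)
    where
    open +-*-Solver
    [x-w]+w≡x : ∀ x w → x - w + w ≡ x
    [x-w]+w≡x = solve 2 (λ x w → x :- w :+ w := x) refl
    x-[v+w]≡[x-w]-v : ∀ x v w → x - (v + w) ≡ x - w - v
    x-[v+w]≡[x-w]-v = solve 3 (λ x v w → x :- (v :+ w) := x :- w :- v) refl

  InCone-scale⁻¹ : ∀ ρ .{{_ : Positive ρ}} {v} → InCone a (λ t → ρ * v t) → InCone a v
  InCone-scale⁻¹ ρ {v} (λs , λs≥0 , Σλa≡ρv) = (λ i → λs i * ρ⁻¹) , λs*ρ⁻¹≥0 , λ t → begin
    sumℚ (λ i → λs i * ρ⁻¹ * toℚ (a i t)) ≡⟨ sumℚ-cong (λ i → xy∙z≈xz∙y (λs i) ρ⁻¹ (toℚ (a i t))) ⟩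
    sumℚ (λ i → λs i * toℚ (a i t) * ρ⁻¹) ≡⟨ *-distribʳ-sumℚ ρ⁻¹ (λ i → λs i * toℚ (a i t)) ⟨
    sumℚ (λ i → λs i * toℚ (a i t)) * ρ⁻¹ ≡⟨ cong (_* ρ⁻¹) (Σλa≡ρv t) ⟩
    ρ * v t * ρ⁻¹                         ≡⟨ xy∙z≈xz∙y ρ (v t) ρ⁻¹ ⟩
    ρ * ρ⁻¹ * v t                         ≡⟨ cong (_* v t) (*-inverseʳ ρ {{pos⇒nonZero ρ}}) ⟩
    1ℚ * v t                              ≡⟨ *-identityˡ (v t) ⟩
    v t                                   ∎
    where
    open ≡-Reasoning
    ρ⁻¹ : ℚ
    ρ⁻¹ = (1/ ρ) {{pos⇒nonZero ρ}}
    λs*ρ⁻¹≥0 : ∀ i → 0ℚ ≤ λs i * ρ⁻¹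
    λs*ρ⁻¹≥0 i = subst (_≤ λs i * ρ⁻¹) (*-zeroˡ ρ⁻¹)
      (*-monoʳ-≤-nonNeg ρ⁻¹ {{pos⇒nonNeg ρ⁻¹ {{1/pos⇒pos ρ}}}} (λs≥0 i))

  InInterior-scale⁻¹ : ∀ ρ .{{_ : Positive ρ}} {v} → InInterior a (λ t → ρ * v t) → InInterior a v
  InInterior-scale⁻¹ ρ {v} (ε , ε>0 , ball⊆C) = ε * ρ⁻¹ , ε*ρ⁻¹>0 , λ x x≈v →
    InCone-scale⁻¹ ρ (ball⊆C (λ t → ρ * x t) λ t → begin
      ∣ ρ * x t - ρ * v t ∣ ≡⟨ cong ∣_∣ (ρx-ρv≡ρ[x-v] ρ (x t) (v t)) ⟩
      ∣ ρ * (x t - v t) ∣   ≡⟨ ∣p*q∣≡∣p∣*∣q∣ ρ (x t - v t) ⟩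
      ∣ ρ ∣ * ∣ x t - v t ∣ ≡⟨ cong (_* ∣ x t - v t ∣) (0≤p⇒∣p∣≡p (<⇒≤ (positive⁻¹ ρ))) ⟩
      ρ * ∣ x t - v t ∣     ≤⟨ *-monoˡ-≤-nonNeg ρ {{pos⇒nonNeg ρ}} (x≈v t) ⟩
      ρ * (ε * ρ⁻¹)         ≡⟨ x∙yz≈y∙xz ρ ε ρ⁻¹ ⟩
      ε * (ρ * ρ⁻¹)         ≡⟨ cong (ε *_) (*-inverseʳ ρ {{pos⇒nonZero ρ}}) ⟩
      ε * 1ℚ                ≡⟨ *-identityʳ ε ⟩
      ε                     ∎)
    where
    open ≤-Reasoning
    open +-*-Solver
    ρ⁻¹ : ℚ
    ρ⁻¹ = (1/ ρ) {{pos⇒nonZero ρ}}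
    ε*ρ⁻¹>0 : 0ℚ < ε * ρ⁻¹
    ε*ρ⁻¹>0 = positive⁻¹ (ε * ρ⁻¹) {{pos*pos⇒pos ε {{positive ε>0}} ρ⁻¹ {{1/pos⇒pos ρ}}}}
    ρx-ρv≡ρ[x-v] : ∀ ρ x v → ρ * x - ρ * v ≡ ρ * (x - v)
    ρx-ρv≡ρ[x-v] = solve 3 (λ ρ x v → ρ :* x :- ρ :* v := ρ :* (x :- v)) refl

  InCone-combination : (μ : Fin N → ℕ) → InCone a (λ t → toℚ (combination (λ j → ℤ.+ μ j) t))
  InCone-combination μ = (λ j → toℚ (ℤ.+ μ j)) , (λ j → toℚ-nonNeg (μ j)) , λ t →
    trans (sumℚ-cong (λ j → sym (toℚ-* (ℤ.+ μ j) (a j t))))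
          (sym (toℚ-sumℤ (λ j → ℤ.+ μ j ℤ.* a j t)))

  InInterior-combination-mono : ∀ q .{{_ : ℕ.NonZero q}} x y → (∀ j → x j ℤ.≤ ℤ.+ q ℤ.* y j) →
    InInterior a (λ t → toℚ (combination x t)) → InInterior a (λ t → toℚ (combination y t))
  InInterior-combination-mono q x y x≤qy x∈C° = InInterior-scale⁻¹ (toℚ (ℤ.+ q)) {{toℚ-pos q}}
    (InInterior-cong x+δ≡qy (InInterior-+ x∈C° (InCone-combination δ)))
    where
    open ≡-Reasoning
    δ : Fin N → ℕ
    δ j = ℤ.∣ ℤ.+ q ℤ.* y j ℤ.- x j ∣
    x+δ≡qy : ∀ t → toℚ (combination x t) + toℚ (combination (λ j → ℤ.+ δ j) t)
                   ≡ toℚ (ℤ.+ q) * toℚ (combination y t)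
    x+δ≡qy t = begin
      toℚ (combination x t) + toℚ (combination (λ j → ℤ.+ δ j) t)
        ≡⟨ toℚ-+ (combination x t) _ ⟨
      toℚ (combination x t ℤ.+ combination (λ j → ℤ.+ δ j) t)
        ≡⟨ cong (λ z → toℚ (combination x t ℤ.+ z))
                (combination-cong (λ j → 0≤i⇒+∣i∣≡i (i≤j⇒0≤j-i (x≤qy j))) t) ⟩
      toℚ (combination x t ℤ.+ combination (λ j → ℤ.+ q ℤ.* y j ℤ.- x j) t)
        ≡⟨ cong toℚ (combination-+-difference x (λ j → ℤ.+ q ℤ.* y j) t) ⟩
      toℚ (combination (λ j → ℤ.+ q ℤ.* y j) t)
        ≡⟨ cong toℚ (combination-* (ℤ.+ q) y t) ⟩
      toℚ (ℤ.+ q ℤ.* combination y t)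
        ≡⟨ toℚ-* (ℤ.+ q) (combination y t) ⟩
      toℚ (ℤ.+ q) * toℚ (combination y t) ∎

↑-cases : ∀ {m k} {P : Fin (m ℕ.+ k) → Set} → (∀ i → P (i ↑ˡ k)) → (∀ j → P (m ↑ʳ j)) → ∀ i → P i
↑-cases {m} {k} {P} left right i with splitAt m i in eq
... | inj₁ i′ = subst P (splitAt⁻¹-↑ˡ eq) (left i′)
... | inj₂ j  = subst P (splitAt⁻¹-↑ʳ eq) (right j)

module Configuration (r J K : ℕ) (c : Fin J → Fin r → ℕ) (d : Fin K → Fin r → ℕ) where

  open Config r J K c d
  open import Data.Integer hiding (suc; sign; _/_)
  open import Data.Integer.Properties
  import Data.Nat.Properties as ℕ
  open import Data.Nat.DivMod using (_/_; m/n*n≤m; 0/n≡0)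
  open import Data.Nat.Divisibility using (_∣_; divides)
  open import Data.Product using (Σ)
  open NatSums
  open Quotients using (m<n*[1+m/n])
  open Integers
  open Rationals using (/-exact)
  open Combinations a
  open Cones a
  open ≡-Reasoning

  a-↑ˡ : ∀ i t → a (i ↑ˡ r) t ≡ unit i t
  a-↑ˡ i t rewrite splitAt-↑ˡ n i r = refl

  a-↑ʳ : ∀ s t → a (n ↑ʳ s) t ≡ extra s t
  a-↑ʳ s t rewrite splitAt-↑ʳ n r s = refl

  extra-↑ˡ↑ˡ : ∀ s s′ → extra s ((s′ ↑ˡ J) ↑ˡ K) ≡ unit s s′
  extra-↑ˡ↑ˡ s s′ rewrite splitAt-↑ˡ M (s′ ↑ˡ J) K | splitAt-↑ˡ r s′ J = refl

  extra-↑ʳ↑ˡ : ∀ s j → extra s ((r ↑ʳ j) ↑ˡ K) ≡ + c j s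
  extra-↑ʳ↑ˡ s j rewrite splitAt-↑ˡ M (r ↑ʳ j) K | splitAt-↑ʳ r J j = refl

  extra-↑ʳ : ∀ s k → extra s (M ↑ʳ k) ≡ - + d k s
  extra-↑ʳ s k rewrite splitAt-↑ʳ M K k = refl

  sumℤ-unit : ∀ {m} (i : Fin m) → sumℤ (unit i) ≡ 1ℤ
  sumℤ-unit {suc m} zero    = cong (_+_ 1ℤ) (sumℤ-zero m)
  sumℤ-unit {suc m} (suc i) = trans (+-identityˡ _) (sumℤ-unit i)

  module _ (balanced : ∀ s → sumℕ (λ j → c j s) ≡ sumℕ (λ k → d k s)) where

    sumℤ-extra : ∀ s → sumℤ (extra s) ≡ 1ℤ
    sumℤ-extra s = begin
      sumℤ (extra s)
        ≡⟨ sumℤ-↑ M (extra s) ⟩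
      sumℤ (λ t → extra s (t ↑ˡ K)) + sumℤ (λ k → extra s (M ↑ʳ k))
        ≡⟨ cong (_+ sumℤ (λ k → extra s (M ↑ʳ k))) (sumℤ-↑ r (λ t → extra s (t ↑ˡ K))) ⟩
      sumℤ (λ s′ → extra s ((s′ ↑ˡ J) ↑ˡ K)) + sumℤ (λ j → extra s ((r ↑ʳ j) ↑ˡ K))
        + sumℤ (λ k → extra s (M ↑ʳ k))
        ≡⟨ cong₂ _+_ (cong₂ _+_ (sumℤ-cong (extra-↑ˡ↑ˡ s)) (sumℤ-cong (extra-↑ʳ↑ˡ s)))
                     (sumℤ-cong (extra-↑ʳ s)) ⟩
      sumℤ (unit s) + sumℤ (λ j → + c j s) + sumℤ (λ k → - + d k s)
        ≡⟨ cong₂ _+_ (cong₂ _+_ (sumℤ-unit s) (sumℤ-pos (λ j → c j s)))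
                     (trans (sumℤ-neg (λ k → + d k s)) (cong -_ (sumℤ-pos (λ k → d k s)))) ⟩
      1ℤ + + Σc + - + Σd
        ≡⟨ cong (λ C → 1ℤ + + C + - + Σd) (balanced s) ⟩
      1ℤ + + Σd + - + Σd
        ≡⟨ +-assoc 1ℤ (+ Σd) (- + Σd) ⟩
      1ℤ + (+ Σd + - + Σd)
        ≡⟨ cong (_+_ 1ℤ) (+-inverseʳ (+ Σd)) ⟩
      1ℤ ∎
      where
      Σc Σd : ℕ
      Σc = sumℕ (λ j → c j s)
      Σd = sumℕ (λ k → d k s)

    sumℤ-generator : ∀ j → sumℤ (a j) ≡ 1ℤ
    sumℤ-generator = ↑-cases (λ i → trans (sumℤ-cong (a-↑ˡ i)) (sumℤ-unit i))
                             (λ s → trans (sumℤ-cong (a-↑ʳ s)) (sumℤ-extra s))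

  -- Indices are 0-based: toℕ j < M are the paper's j ≤ M, which carry Λ_j^(-l_j-1) and whose
  -- factorials l_j! form the numerator of the coefficient.
  𝟙[<M] : Fin N → ℕ
  𝟙[<M] j = if does (toℕ j ℕ.<? M) then 1 else 0

  numeratorExponent : (Fin N → ℕ) → Fin N → ℕ
  numeratorExponent l j = if does (toℕ j ℕ.<? M) then l j else 0

  denominatorExponent : (Fin N → ℕ) → Fin N → ℕ
  denominatorExponent l j = if does (toℕ j ℕ.<? M) then 0 else l j

  numFactor≡ : ∀ l j → numFactor l j ≡ numeratorExponent l j !
  numFactor≡ l j with does (toℕ j ℕ.<? M)
  ... | true  = refl
  ... | false = refl

  denFactor≡ : ∀ l j → denFactor l j ≡ denominatorExponent l j !
  denFactor≡ l j with does (toℕ j ℕ.<? M)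
  ... | true  = refl
  ... | false = refl

  numeratorExponent-/ : ∀ q .{{_ : ℕ.NonZero q}} l j →
                        numeratorExponent l j / q ≡ numeratorExponent (λ i → l i / q) j
  numeratorExponent-/ q l j with does (toℕ j ℕ.<? M)
  ... | true  = refl
  ... | false = 0/n≡0 q

  denominatorExponent-/ : ∀ q .{{_ : ℕ.NonZero q}} l j →
                          denominatorExponent l j / q ≡ denominatorExponent (λ i → l i / q) j
  denominatorExponent-/ q l j with does (toℕ j ℕ.<? M)
  ... | true  = 0/n≡0 q
  ... | false = refl

  -weight-split : ∀ l j →
                  - weight l j ≡ + (𝟙[<M] j ℕ.+ numeratorExponent l j) - + denominatorExponent l j
  -weight-split l j with does (toℕ j ℕ.<? M)
  ... | true  = trans (neg-involutive (+ suc (l j))) (sym (+-identityʳ (+ suc (l j))))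
  ... | false = sym (+-identityˡ _)

  sumℤ-[-weight] : ∀ l → sumℤ (λ j → - weight l j)
                         ≡ + M + (+ sumℕ (numeratorExponent l) - + sumℕ (denominatorExponent l))
  sumℤ-[-weight] l = begin
    sumℤ (λ j → - weight l j)
      ≡⟨ sumℤ-cong (-weight-split l) ⟩
    sumℤ (λ j → + (𝟙[<M] j ℕ.+ num j) - + den j)
      ≡⟨ sumℤ-pos-difference (λ j → 𝟙[<M] j ℕ.+ num j) den ⟩
    + sumℕ (λ j → 𝟙[<M] j ℕ.+ num j) - + sumℕ den
      ≡⟨ cong (λ x → + x - + sumℕ den) Σ[𝟙+num]≡M+Σnum ⟩
    + (M ℕ.+ sumℕ num) - + sumℕ den
      ≡⟨ cong (_- + sumℕ den) (pos-+ M (sumℕ num)) ⟩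
    + M + + sumℕ num - + sumℕ den
      ≡⟨ +-assoc (+ M) (+ sumℕ num) (- + sumℕ den) ⟩
    + M + (+ sumℕ num - + sumℕ den) ∎
    where
    num den : Fin N → ℕ
    num = numeratorExponent l
    den = denominatorExponent l
    Σ[𝟙+num]≡M+Σnum : sumℕ (λ j → 𝟙[<M] j ℕ.+ num j) ≡ M ℕ.+ sumℕ num
    Σ[𝟙+num]≡M+Σnum = trans (sumℕ-distrib-+ 𝟙[<M] num)
      (cong (ℕ._+ sumℕ num) (count-< (ℕ.≤-trans (ℕ.m≤m+n M K) (ℕ.m≤m+n n r))))

  -weight≤q*-weight[/q] : ∀ q .{{_ : ℕ.NonZero q}} l j →
                          - weight l j ≤ + q * - weight (λ i → l i / q) j
  -weight≤q*-weight[/q] q l j with does (toℕ j ℕ.<? M)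
  ... | true  = subst₂ _≤_ (sym (neg-involutive _))
                       (trans (pos-* q _) (cong (_*_ (+ q)) (sym (neg-involutive _))))
                       (+≤+ (m<n*[1+m/n] (l j) q))
  ... | false = subst (- + l j ≤_) (trans (cong -_ (pos-* q (l j / q))) (neg-distribʳ-* (+ q) _))
                      (neg-mono-≤ (+≤+ (subst (ℕ._≤ l j) (ℕ.*-comm (l j / q) q) (m/n*n≤m (l j) q))))

  module _ (balanced : ∀ s → sumℕ (λ j → c j s) ≡ sumℕ (λ k → d k s))
           (minimal : (v : Fin n → ℤ) → InInterior a (λ t → toℚ (v t)) → + M ≤ sumℤ v)
           (u : Fin n → ℤ) (-u∈C° : InInterior a (λ t → toℚ (- u t)))
           (l : Fin N → ℕ) (support : Support l u) where

    Σ⌊den/q⌋≤Σ⌊num/q⌋ : ∀ q .{{_ : ℕ.NonZero q}} →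
                        sumℕ (λ j → denominatorExponent l j / q)
                          ℕ.≤ sumℕ (λ j → numeratorExponent l j / q)
    Σ⌊den/q⌋≤Σ⌊num/q⌋ q = subst₂ ℕ._≤_ (sumℕ-cong (λ j → sym (denominatorExponent-/ q l j)))
                                       (sumℕ-cong (λ j → sym (numeratorExponent-/ q l j)))
                            (drop‿+≤+ (0≤i-j⇒j≤i (i≤i+j⇒0≤j M≤M+Σnum-Σden)))
      where
      l/q : Fin N → ℕ
      l/q j = l j / q
      w[l]∈C° : InInterior a (λ t → toℚ (combination (λ j → - weight l j) t))
      w[l]∈C° = InInterior-cong (λ t → cong toℚ (sym (trans (combination-neg (weight l) t)
                                                            (cong -_ (support t)))))
                                -u∈C°
      w[l/q]∈C° : InInterior a (λ t → toℚ (combination (λ j → - weight l/q j) t))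
      w[l/q]∈C° = InInterior-combination-mono q _ _ (-weight≤q*-weight[/q] q l) w[l]∈C°
      M≤M+Σnum-Σden : + M ≤ + M + (+ sumℕ (numeratorExponent l/q) - + sumℕ (denominatorExponent l/q))
      M≤M+Σnum-Σden = subst (+ M ≤_)
        (trans (sumℤ-combination (sumℤ-generator balanced) _) (sumℤ-[-weight] l/q))
        (minimal _ w[l/q]∈C°)

  ∣⇒coeff-integral : ∀ l → prodℕ (denFactor l) ∣ prodℕ (numFactor l) → Σ ℤ λ z → coeff l ≡ toℚ z
  ∣⇒coeff-integral l (divides k ∏num≡k*∏den) =
    sign σ * + k , /-exact (sign σ * + ∏num) (sign σ * + k) ∏den {{∏den≢0}} (begin
      sign σ * + ∏num           ≡⟨ cong (λ P → sign σ * + P) ∏num≡k*∏den ⟩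
      sign σ * + (k ℕ.* ∏den)   ≡⟨ cong (sign σ *_) (pos-* k ∏den) ⟩
      sign σ * (+ k * + ∏den)   ≡⟨ *-assoc (sign σ) (+ k) (+ ∏den) ⟨
      sign σ * + k * + ∏den     ∎)
    where
    σ ∏num ∏den : ℕ
    σ = sumℕ (numeratorExponent l)
    ∏num = prodℕ (numFactor l)
    ∏den = prodℕ (denFactor l)
    ∏den≢0 : ℕ.NonZero ∏den
    ∏den≢0 = prodℕ-nonZero (denFactor l)
               (λ j → subst ℕ.NonZero (sym (denFactor≡ l j)) (denominatorExponent l j ℕ.!≢0))

open import Data.Nat using (ℕ; _≤_)
open import Data.Integer as ℤ using (ℤ; +_; -_)
open import Data.Fin using (Fin)
open import Data.Product using (Σ; _×_)
open import Data.Sum using (_⊎_)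
open import Relation.Binary.PropositionalEquality using (_≡_; _≢_)
open import Relation.Nullary using (¬_)

proposition7p19 : (r J K : ℕ) → 1 ≤ r → 1 ≤ J → 1 ≤ K →
    (c : Fin J → Fin r → ℕ) → (d : Fin K → Fin r → ℕ) →
    ((s : Fin r) → sumℕ (λ j → c j s) ≡ sumℕ (λ k → d k s)) →
    ((j : Fin J) → ¬ ((s : Fin r) → c j s ≡ 0)) →
    ((k : Fin K) → ¬ ((s : Fin r) → d k s ≡ 0)) →
    ((j : Fin J) → (k : Fin K) → ¬ ((s : Fin r) → c j s ≡ d k s)) →
    ((s : Fin r) → (Σ (Fin J) λ j → c j s ≢ 0) ⊎ (Σ (Fin K) λ k → d k s ≢ 0)) →
    let open Config r J K c d in
    (Σ (Fin n → ℤ) λ u → InInterior a (λ t → toℚ (u t)) × sumℤ u ≡ + M) →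
    ((u : Fin n → ℤ) → InInterior a (λ t → toℚ (u t)) → + M ℤ.≤ sumℤ u) →
    (u : Fin n → ℤ) → InInterior a (λ t → toℚ (- u t)) → IntegralCoeffs u
proposition7p19 r J K _ _ _ c d balanced _ _ _ _ _ minimal u -u∈C° l support =
  ∣⇒coeff-integral l
    (subst₂ _∣_ (prodℕ-cong (λ j → sym (denFactor≡ l j))) (prodℕ-cong (λ j → sym (numFactor≡ l j)))
      (landau (numeratorExponent l) (denominatorExponent l)
              (Σ⌊den/q⌋≤Σ⌊num/q⌋ balanced minimal u -u∈C° l support)))
  where
  open Configuration r J K c d
  open NatSums using (prodℕ-cong)
  open Legendre using (landau)
  open import Data.Nat.Divisibility using (_∣_)
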